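{- Let $D$ be a finite set and let $S_p,S_q$ be fixed finite multisets of elements of $D$. Independently flag each element of $S_p$ and of $S_q$ with probability $1/2$; let $S_{p0}$ (resp. $S_{q0}$) be the flagged elements of $S_p$ (resp. $S_q$) and $S_{p1}$ (resp. $S_{q1}$) the unflagged ones, with multiplicity functions $X^{(p0)},X^{(p1)},X^{(q0)},X^{(q1)}$. Let $Z=\sum_{u\in D}\big(|X^{(p0)}_u-X^{(q0)}_u|+|X^{(p1)}_u-X^{(q1)}_u|-|X^{(p0)}_u-X^{(p1)}_u|-|X^{(q0)}_u-X^{(q1)}_u|\big)$. Let $N_p$ be the number of elements of $S_p$ whose value appears at least twice in $S_p$, and $N_q$ the number of elements of $S_q$ whose value appears at least twice in $S_p\cup S_q$. Then $$\mathbf{Pr}\big[Z<N_p/6-2N_q-100\big]<1/2.$$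
   Context: The probability is over the random flagging only. -}

module Defs where

open import Data.Bool using (Bool; true; false; if_then_else_; _∧_)
import Data.Bool.Properties as B
open import Data.Nat using (ℕ; zero; suc; _+_; _*_; _≤?_; ∣_-_∣)
open import Data.Fin using (Fin)
import Data.Fin.Properties as F
open import Data.Integer using (ℤ; +_; _-_; _<?_) renaming (_+_ to _+ℤ_; _*_ to _*ℤ_)
open import Data.List using (List; []; _∷_; map; filter; length; cartesianProduct; foldr)
open import Data.List.Base using (allFin)
open import Data.Vec using (Vec; []; _∷_; toList; _++_)
open import Data.Product using (_×_; _,_)
open import Relation.Nullary using (does)

-- Number of positions i with flag fs[i] ≡ b and value xs[i] ≡ u.
-- Convention: flag true = "flagged" (the 0-part), flag false = unflagged (the 1-part).
multF : ∀ {d m} → Vec (Fin d) m → Vec Bool m → Bool → Fin d → ℕ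
multF [] [] b u = 0
multF (x ∷ xs) (f ∷ fs) b u =
  (if does (x F.≟ u) ∧ does (f B.≟ b) then 1 else 0) + multF xs fs b u

count : ∀ {d k} → Vec (Fin d) k → Fin d → ℕ
count [] u = 0
count (x ∷ xs) u = (if does (x F.≟ u) then 1 else 0) + count xs u

zTerm : ∀ {d m n} → Vec (Fin d) m → Vec (Fin d) n → Vec Bool m → Vec Bool n → Fin d → ℤ
zTerm Sp Sq fp fq u =
  let p0 = multF Sp fp true u
      p1 = multF Sp fp false u
      q0 = multF Sq fq true u
      q1 = multF Sq fq false u
  in (+ (∣ p0 - q0 ∣ + ∣ p1 - q1 ∣)) - (+ (∣ p0 - p1 ∣ + ∣ q0 - q1 ∣))

sumℤ : List ℤ → ℤ
sumℤ = foldr _+ℤ_ (+ 0)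

Z : ∀ {d m n} → Vec (Fin d) m → Vec (Fin d) n → Vec Bool m → Vec Bool n → ℤ
Z {d} Sp Sq fp fq = sumℤ (map (zTerm Sp Sq fp fq) (allFin d))

Np : ∀ {d m} → Vec (Fin d) m → ℕ
Np Sp = length (filter (λ x → 2 ≤? count Sp x) (toList Sp))

Nq : ∀ {d m n} → Vec (Fin d) m → Vec (Fin d) n → ℕ
Nq Sp Sq = length (filter (λ x → 2 ≤? count (Sp ++ Sq) x) (toList Sq))

-- all 2^n flaggings of n elements (each equally likely: uniform distribution)
allFlags : (n : ℕ) → List (Vec Bool n)
allFlags zero = [] ∷ []
allFlags (suc n) = map (true ∷_) (allFlags n) Data.List.++ map (false ∷_) (allFlags n)

-- The event Z < N_p/6 - 2 N_q - 100, multiplied through by 6 (exact over ℤ):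
-- 6 Z < N_p - 12 N_q - 600.
-- Number of flaggings (fp, fq) in the event.
badCount : ∀ {d m n} → Vec (Fin d) m → Vec (Fin d) n → ℕ
badCount {d} {m} {n} Sp Sq =
  length (filter (λ (pq : Vec Bool m × Vec Bool n) → let (fp , fq) = pq in
            (+ 6) *ℤ Z Sp Sq fp fq <? (+ Np Sp) - (+ (12 * Nq Sp Sq)) - (+ 600))
         (cartesianProduct (allFlags m) (allFlags n)))

{-# OPTIONS --safe #-}
-- Write R(f) = Σ_u min(X^{p0}_u, X^{p1}_u) (splitOverlap) for a flagging f of S_p. Value by value,
-- |p₀ - q₀| + |p₁ - q₁| ≥ p₀ + p₁ + |q₀ - q₁| - 2 min(p₀ + p₁, q₀ + q₁), and the minimum vanishes
-- unless u occurs twice in S_p ∪ S_q; summing gives Z ≥ 2R(f) - 2N_q, so the event forces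
-- 12 R(f) + 600 < N_p, a condition on the flagging of S_p alone.
-- Fix a flagging μ that splits every value of S_p as evenly as possible. Then N_p ≤ 3R(μ) and
-- R(μ) ≤ R(f) + R(μ ⊕ f) for every f, so the measure-preserving involution f ↦ μ ⊕ f maps the
-- event into its complement, and its probability is at most 1/2. For strictness, move from the
-- all-unflagged flagging to μ one position at a time: R grows by at most one per step, so some
-- flagging w on the way has N_p ≤ 12 R(w) ≤ N_p + 12, and neither w nor μ ⊕ w is in the event.
module Submission where

open import Defs
open import Data.Bool using (Bool; true; false; if_then_else_; _∧_; not; _xor_)
import Data.Bool.Properties as B
open import Data.Nat
open import Data.Nat.Properties
open import Data.Nat.ListAction using (sum)
open import Data.Nat.Tactic.RingSolver using (solve-∀)
open import Data.Fin using (Fin; zero; suc)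
import Data.Fin.Properties as F
open import Data.List using (List; []; _∷_; map; filter; length; cartesianProduct; _++_)
open import Data.List.Base using (allFin)
import Data.List.Properties as L
open import Data.Vec using (Vec; []; _∷_; replicate; toList; zipWith)
import Data.Vec as V
open import Data.Product using (_×_; _,_; ∃-syntax; proj₁; proj₂)
open import Data.Integer as ℤ using (+_)
import Data.Integer.Properties as ℤ
import Data.Integer.Tactic.RingSolver as ℤ
open import Data.Sum using (inj₁; inj₂; [_,_])
open import Function using (_∘_)
open import Level using (Level)
open import Relation.Nullary using (Dec; yes; no; does; ¬_; contradiction)
open import Relation.Unary using (Pred; Decidable)
open import Relation.Unary.Properties using (_∪?_)
open import Data.List.Membership.Propositional using (_∈_; lose)
open import Data.List.Membership.Propositional.Properties using (∈-map⁺; ∈-++⁺ˡ; ∈-++⁺ʳ)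
open import Data.List.Relation.Unary.Any using (here)
open import Data.List.Relation.Unary.All using (universal)
import Data.List.Relation.Unary.All.Properties as All
open import Relation.Binary.PropositionalEquality
  using (_≡_; refl; sym; trans; cong; cong₂; subst; subst₂; module ≡-Reasoning)
open import Algebra.Properties.CommutativeSemigroup +-commutativeSemigroup
  using () renaming (interchange to +-interchange)
open import Algebra.Properties.CommutativeSemigroup *-commutativeSemigroup using (xy∙z≈xz∙y)

module _ {a} {A : Set a} where

  sum-map-+ : ∀ (f g : A → ℕ) xs →
              sum (map (λ x → f x + g x) xs) ≡ sum (map f xs) + sum (map g xs)
  sum-map-+ f g []       = refl
  sum-map-+ f g (x ∷ xs) = trans (cong (_+_ (f x + g x)) (sum-map-+ f g xs))
                                 (+-interchange (f x) (g x) _ _)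

  sum-map-* : ∀ k (f : A → ℕ) xs → sum (map (λ x → k * f x) xs) ≡ k * sum (map f xs)
  sum-map-* k f []       = sym (*-zeroʳ k)
  sum-map-* k f (x ∷ xs) = trans (cong (_+_ (k * f x)) (sum-map-* k f xs))
                                 (sym (*-distribˡ-+ k (f x) _))

  sum-map-mono-≤ : ∀ {f g : A → ℕ} → (∀ x → f x ≤ g x) → ∀ xs →
                   sum (map f xs) ≤ sum (map g xs)
  sum-map-mono-≤ f≤g []       = z≤n
  sum-map-mono-≤ f≤g (x ∷ xs) = +-mono-≤ (f≤g x) (sum-map-mono-≤ f≤g xs)

∑ : ∀ {d} → (Fin d → ℕ) → ℕ
∑ {d} h = sum (map h (allFin d))

∑-cong : ∀ {d} {g h : Fin d → ℕ} → (∀ u → g u ≡ h u) → ∑ g ≡ ∑ h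
∑-cong {d} g≗h = cong sum (L.map-cong g≗h (allFin d))

∑-zero : ∀ {d} → ∑ {d} (λ _ → 0) ≡ 0
∑-zero {d} = go (allFin d)
  where
  go : ∀ (us : List (Fin d)) → sum (map (λ _ → 0) us) ≡ 0
  go []       = refl
  go (_ ∷ us) = go us

∑-suc : ∀ {d} (h : Fin (suc d) → ℕ) → ∑ h ≡ h zero + ∑ (h ∘ suc)
∑-suc {d} h = cong (λ us → h zero + sum us)
  (trans (L.map-tabulate suc h) (sym (L.map-tabulate (λ u → u) (h ∘ suc))))

∑-indicator : ∀ {d} (x : Fin d) (g : Fin d → ℕ) →
              ∑ (λ u → if does (x F.≟ u) then g u else 0) ≡ g x
∑-indicator {suc d} zero    g = begin
  ∑ (λ u → if does (zero F.≟ u) then g u else 0) ≡⟨ ∑-suc (λ u → if does (zero F.≟ u) then g u else 0) ⟩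
  g zero + ∑ {d} (λ _ → 0)                        ≡⟨ cong (_+_ (g zero)) (∑-zero {d}) ⟩
  g zero + 0                                      ≡⟨ +-identityʳ (g zero) ⟩
  g zero                                          ∎
  where open ≡-Reasoning
∑-indicator {suc d} (suc x) g =
  trans (∑-suc (λ u → if does (suc x F.≟ u) then g u else 0)) (∑-indicator x (g ∘ suc))

2*[m⊓n]+∣m-n∣≡m+n : ∀ m n → 2 * (m ⊓ n) + ∣ m - n ∣ ≡ m + n
2*[m⊓n]+∣m-n∣≡m+n zero    n       = refl
2*[m⊓n]+∣m-n∣≡m+n (suc m) zero    = sym (+-identityʳ (suc m))
2*[m⊓n]+∣m-n∣≡m+n (suc m) (suc n) = begin
  2 * suc (m ⊓ n) + ∣ m - n ∣   ≡⟨ shift (m ⊓ n) ∣ m - n ∣ ⟩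
  2 + (2 * (m ⊓ n) + ∣ m - n ∣) ≡⟨ cong (_+_ 2) (2*[m⊓n]+∣m-n∣≡m+n m n) ⟩
  2 + (m + n)                   ≡⟨ cong suc (+-suc m n) ⟨
  suc m + suc n                 ∎
  where
  open ≡-Reasoning
  shift : ∀ k δ → 2 * suc k + δ ≡ 2 + (2 * k + δ)
  shift = solve-∀

∣m-n∣≤m+n : ∀ m n → ∣ m - n ∣ ≤ m + n
∣m-n∣≤m+n m n = ≤-trans (∣m-n∣≤m⊔n m n) (m⊔n≤m+n m n)

p₀+p₁+∣q₀-q₁∣≤∣p₀-q₀∣+∣p₁-q₁∣+2*[P⊓Q] : ∀ p₀ p₁ q₀ q₁ →
  p₀ + p₁ + ∣ q₀ - q₁ ∣ ≤ ∣ p₀ - q₀ ∣ + ∣ p₁ - q₁ ∣ + 2 * ((p₀ + p₁) ⊓ (q₀ + q₁))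
p₀+p₁+∣q₀-q₁∣≤∣p₀-q₀∣+∣p₁-q₁∣+2*[P⊓Q] p₀ p₁ q₀ q₁ = begin
  p₀ + p₁ + ∣ q₀ - q₁ ∣       ≤⟨ ⊓-glb via-p via-q ⟩
  (A + 2 * P) ⊓ (A + 2 * Q) ≡⟨ +-distribˡ-⊓ A (2 * P) (2 * Q) ⟨
  A + (2 * P) ⊓ (2 * Q)     ≡⟨ cong (_+_ A) (*-distribˡ-⊓ 2 P Q) ⟨
  A + 2 * (P ⊓ Q)           ∎
  where
  open ≤-Reasoning
  A P Q : ℕ
  A = ∣ p₀ - q₀ ∣ + ∣ p₁ - q₁ ∣
  P = p₀ + p₁
  Q = q₀ + q₁

  via-q : p₀ + p₁ + ∣ q₀ - q₁ ∣ ≤ A + 2 * Q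
  via-q = begin
    p₀ + p₁ + ∣ q₀ - q₁ ∣
      ≤⟨ +-mono-≤ (+-mono-≤ (m≤∣m-n∣+n p₀ q₀) (m≤∣m-n∣+n p₁ q₁)) (∣m-n∣≤m+n q₀ q₁) ⟩
    (∣ p₀ - q₀ ∣ + q₀) + (∣ p₁ - q₁ ∣ + q₁) + (q₀ + q₁)
      ≡⟨ regroup ∣ p₀ - q₀ ∣ ∣ p₁ - q₁ ∣ q₀ q₁ ⟩
    A + 2 * Q ∎
    where
    regroup : ∀ x y a b → (x + a) + (y + b) + (a + b) ≡ x + y + 2 * (a + b)
    regroup = solve-∀

  via-p : p₀ + p₁ + ∣ q₀ - q₁ ∣ ≤ A + 2 * P
  via-p = begin
    p₀ + p₁ + ∣ q₀ - q₁ ∣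
      ≤⟨ +-monoʳ-≤ P (∣-∣-triangle q₀ p₀ q₁) ⟩
    p₀ + p₁ + (∣ q₀ - p₀ ∣ + ∣ p₀ - q₁ ∣)
      ≤⟨ +-monoʳ-≤ P (+-mono-≤ (≤-reflexive (∣-∣-comm q₀ p₀)) (∣-∣-triangle p₀ p₁ q₁)) ⟩
    p₀ + p₁ + (∣ p₀ - q₀ ∣ + (∣ p₀ - p₁ ∣ + ∣ p₁ - q₁ ∣))
      ≤⟨ +-monoʳ-≤ P (+-monoʳ-≤ ∣ p₀ - q₀ ∣ (+-monoˡ-≤ ∣ p₁ - q₁ ∣ (∣m-n∣≤m+n p₀ p₁))) ⟩
    p₀ + p₁ + (∣ p₀ - q₀ ∣ + (p₀ + p₁ + ∣ p₁ - q₁ ∣))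
      ≡⟨ regroup p₀ p₁ ∣ p₀ - q₀ ∣ ∣ p₁ - q₁ ∣ ⟩
    A + 2 * P ∎
    where
    regroup : ∀ a b x y → a + b + (x + (a + b + y)) ≡ x + y + 2 * (a + b)
    regroup = solve-∀

m⊓n≤[2≤m+n]n : ∀ m n (2≤m+n? : Dec (2 ≤ m + n)) → m ⊓ n ≤ (if does 2≤m+n? then n else 0)
m⊓n≤[2≤m+n]n m n (yes _)      = m⊓n≤n m n
m⊓n≤[2≤m+n]n m n (no 2≰m+n) = m+n<2⇒m⊓n≤0 m n 2≰m+n
  where
  m+n<2⇒m⊓n≤0 : ∀ m n → ¬ 2 ≤ m + n → m ⊓ n ≤ 0
  m+n<2⇒m⊓n≤0 zero    n       _      = z≤n
  m+n<2⇒m⊓n≤0 (suc m) zero    _      = z≤n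
  m+n<2⇒m⊓n≤0 (suc m) (suc n) 2≰m+n = contradiction (s≤s (≤-trans (s≤s z≤n) (m≤n+m (suc n) m))) 2≰m+n

Z-summand-bound : ∀ p₀ p₁ q₀ q₁ →
  2 * (p₀ ⊓ p₁) + (∣ p₀ - p₁ ∣ + ∣ q₀ - q₁ ∣)
    ≤ ∣ p₀ - q₀ ∣ + ∣ p₁ - q₁ ∣
      + 2 * (if does (2 ≤? p₀ + p₁ + (q₀ + q₁)) then q₀ + q₁ else 0)
Z-summand-bound p₀ p₁ q₀ q₁ = begin
  2 * (p₀ ⊓ p₁) + (∣ p₀ - p₁ ∣ + ∣ q₀ - q₁ ∣)
    ≡⟨ +-assoc (2 * (p₀ ⊓ p₁)) ∣ p₀ - p₁ ∣ ∣ q₀ - q₁ ∣ ⟨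
  2 * (p₀ ⊓ p₁) + ∣ p₀ - p₁ ∣ + ∣ q₀ - q₁ ∣
    ≡⟨ cong (_+ ∣ q₀ - q₁ ∣) (2*[m⊓n]+∣m-n∣≡m+n p₀ p₁) ⟩
  p₀ + p₁ + ∣ q₀ - q₁ ∣
    ≤⟨ p₀+p₁+∣q₀-q₁∣≤∣p₀-q₀∣+∣p₁-q₁∣+2*[P⊓Q] p₀ p₁ q₀ q₁ ⟩
  ∣ p₀ - q₀ ∣ + ∣ p₁ - q₁ ∣ + 2 * ((p₀ + p₁) ⊓ (q₀ + q₁))
    ≤⟨ +-monoʳ-≤ (∣ p₀ - q₀ ∣ + ∣ p₁ - q₁ ∣) (*-monoʳ-≤ 2 (m⊓n≤[2≤m+n]n (p₀ + p₁) (q₀ + q₁) (2 ≤? _))) ⟩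
  ∣ p₀ - q₀ ∣ + ∣ p₁ - q₁ ∣ + 2 * (if does (2 ≤? p₀ + p₁ + (q₀ + q₁)) then q₀ + q₁ else 0) ∎
  where open ≤-Reasoning

m+n≤3*[m⊓n] : ∀ {m n} → m ≤ suc n → n ≤ suc m → 2 ≤ m + n → m + n ≤ 3 * (m ⊓ n)
m+n≤3*[m⊓n] {zero}          _   n≤1 2≤n   = contradiction (≤-trans 2≤n n≤1) λ { (s≤s ()) }
m+n≤3*[m⊓n] {suc m} {zero}  m≤0 _   2≤m+0 =
  contradiction (≤-trans 2≤m+0 (≤-trans (≤-reflexive (+-identityʳ (suc m))) m≤0)) λ { (s≤s ()) }
m+n≤3*[m⊓n] {suc m} {suc n} (s≤s m≤1+n) (s≤s n≤1+m) _ = begin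
  suc m + suc n           ≡⟨ cong suc (+-suc m n) ⟩
  2 + (m + n)             ≤⟨ +-monoʳ-≤ 2 m+n≤k+1+k ⟩
  2 + (k + suc k)         ≡⟨ shift k ⟩
  3 + 2 * k               ≤⟨ +-monoʳ-≤ 3 (*-monoˡ-≤ k (n≤1+n 2)) ⟩
  3 + 3 * k               ≡⟨ *-suc 3 k ⟨
  3 * suc k               ∎
  where
  open ≤-Reasoning
  k : ℕ
  k = m ⊓ n
  shift : ∀ k → 2 + (k + suc k) ≡ 3 + 2 * k
  shift = solve-∀
  m+n≤k+1+k : m + n ≤ k + suc k
  m+n≤k+1+k with ⊓-sel m n
  ... | inj₁ m⊓n≡m rewrite m⊓n≡m = +-monoʳ-≤ m n≤1+m
  ... | inj₂ m⊓n≡n rewrite m⊓n≡n = subst (m + n ≤_) (+-comm (suc n) n) (+-monoˡ-≤ n m≤1+n)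

balanced-duplicates-bound : ∀ {m n} → m ≤ suc n → n ≤ suc m → (2≤m+n? : Dec (2 ≤ m + n)) →
                            (if does 2≤m+n? then m + n else 0) ≤ 3 * (m ⊓ n)
balanced-duplicates-bound m≤1+n n≤1+m (yes 2≤m+n) = m+n≤3*[m⊓n] m≤1+n n≤1+m 2≤m+n
balanced-duplicates-bound m≤1+n n≤1+m (no _)      = z≤n

[a+b]⊓[c+d]≤[a+c]⊓[b+d]+[b+c]⊓[a+d] : ∀ a b c d →
  (a + b) ⊓ (c + d) ≤ (a + c) ⊓ (b + d) + (b + c) ⊓ (a + d)
[a+b]⊓[c+d]≤[a+c]⊓[b+d]+[b+c]⊓[a+d] a b c d = begin
  (a + b) ⊓ (c + d)
    ≤⟨ ⊓-glb (⊓-glb (via-ab (+-mono-≤ (m≤m+n a c) (m≤m+n b c)))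
                    (via-cd (+-mono-≤ (m≤n+m c a) (m≤n+m d a))))
             (⊓-glb (via-cd (swap (b + c) (b + d) (+-mono-≤ (m≤n+m c b) (m≤n+m d b))))
                    (via-ab (swap (a + d) (b + d) (+-mono-≤ (m≤m+n a d) (m≤m+n b d))))) ⟩
  ((a + c + (b + c)) ⊓ (a + c + (a + d))) ⊓ ((b + d + (b + c)) ⊓ (b + d + (a + d)))
    ≡⟨ cong₂ _⊓_ (+-distribˡ-⊓ (a + c) (b + c) (a + d)) (+-distribˡ-⊓ (b + d) (b + c) (a + d)) ⟨
  ((a + c) + (b + c) ⊓ (a + d)) ⊓ ((b + d) + (b + c) ⊓ (a + d))
    ≡⟨ +-distribʳ-⊓ ((b + c) ⊓ (a + d)) (a + c) (b + d) ⟨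
  (a + c) ⊓ (b + d) + (b + c) ⊓ (a + d) ∎
  where
  open ≤-Reasoning
  via-ab : ∀ {x} → a + b ≤ x → (a + b) ⊓ (c + d) ≤ x
  via-ab = ≤-trans (m⊓n≤m (a + b) (c + d))
  via-cd : ∀ {x} → c + d ≤ x → (a + b) ⊓ (c + d) ≤ x
  via-cd = ≤-trans (m⊓n≤n (a + b) (c + d))
  swap : ∀ {x} y z → x ≤ y + z → x ≤ z + y
  swap {x} y z = subst (x ≤_) (+-comm y z)

⟦_⟧ : Bool → ℕ
⟦ b ⟧ = if b then 1 else 0

length-filter-∷ : ∀ {a p} {A : Set a} {P : Pred A p} (P? : Decidable P) x xs →
                  length (filter P? (x ∷ xs)) ≡ ⟦ does (P? x) ⟧ + length (filter P? xs)
length-filter-∷ P? x xs with does (P? x)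
... | true  = refl
... | false = refl

module _ {a b p} {A : Set a} {B : Set b} {P : Pred A p} (P? : Decidable P) where

  length-filter-map : ∀ (g : B → A) xs → length (filter P? (map g xs)) ≡ length (filter (P? ∘ g) xs)
  length-filter-map g []       = refl
  length-filter-map g (x ∷ xs) with does (P? (g x))
  ... | true  = cong suc (length-filter-map g xs)
  ... | false = length-filter-map g xs

module _ {a p q} {A : Set a} {P : Pred A p} {Q : Pred A q} (P? : Decidable P) (Q? : Decidable Q) where

  length-filter-disjoint : (∀ {x} → P x → ¬ Q x) → ∀ xs →
    length (filter P? xs) + length (filter Q? xs) ≡ length (filter (P? ∪? Q?) xs)
  length-filter-disjoint disjoint []       = refl
  length-filter-disjoint disjoint (x ∷ xs) with P? x | Q? x
  ... | yes px | yes qx = contradiction qx (disjoint px)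
  ... | yes _  | no  _  = cong suc (length-filter-disjoint disjoint xs)
  ... | no  _  | yes _  = trans (+-suc _ _) (cong suc (length-filter-disjoint disjoint xs))
  ... | no  _  | no  _  = length-filter-disjoint disjoint xs

  length-filter-disjoint-< : (∀ {x} → P x → ¬ Q x) → ∀ {xs w} → w ∈ xs → ¬ P w → ¬ Q w →
    length (filter P? xs) + length (filter Q? xs) < length xs
  length-filter-disjoint-< disjoint {xs} w∈xs ¬pw ¬qw = begin-strict
    length (filter P? xs) + length (filter Q? xs) ≡⟨ length-filter-disjoint disjoint xs ⟩
    length (filter (P? ∪? Q?) xs)                 <⟨ L.filter-notAll (P? ∪? Q?) xs (lose w∈xs [ ¬pw , ¬qw ]) ⟩
    length xs                                     ∎
    where open ≤-Reasoning

module _ {a b p q} {A : Set a} {B : Set b} {P : Pred (A × B) p} {Q : Pred A q}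
         (P? : Decidable P) (Q? : Decidable Q) where

  length-filter-cartesianProduct : (∀ {x y} → P (x , y) → Q x) → ∀ xs ys →
    length (filter P? (cartesianProduct xs ys)) ≤ length (filter Q? xs) * length ys
  length-filter-cartesianProduct P⇒Q []       ys = z≤n
  length-filter-cartesianProduct P⇒Q (x ∷ xs) ys = begin
    length (filter P? (row ++ rest))
      ≡⟨ cong length (L.filter-++ P? row rest) ⟩
    length (filter P? row ++ filter P? rest)
      ≡⟨ L.length-++ (filter P? row) ⟩
    length (filter P? row) + length (filter P? rest)
      ≤⟨ +-mono-≤ (row-bound (Q? x)) (length-filter-cartesianProduct P⇒Q xs ys) ⟩
    ⟦ does (Q? x) ⟧ * length ys + length (filter Q? xs) * length ys
      ≡⟨ *-distribʳ-+ (length ys) ⟦ does (Q? x) ⟧ (length (filter Q? xs)) ⟨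
    (⟦ does (Q? x) ⟧ + length (filter Q? xs)) * length ys
      ≡⟨ cong (_* length ys) (length-filter-∷ Q? x xs) ⟨
    length (filter Q? (x ∷ xs)) * length ys ∎
    where
    open ≤-Reasoning
    row rest : List (A × B)
    row = map (x ,_) ys
    rest = cartesianProduct xs ys
    row-bound : (Q?x : Dec (Q x)) → length (filter P? row) ≤ ⟦ does Q?x ⟧ * length ys
    row-bound (yes _)  = ≤-trans (L.length-filter P? row)
                                 (≤-reflexive (trans (L.length-map (x ,_) ys) (sym (+-identityʳ (length ys)))))
    row-bound (no ¬qx) = ≤-reflexive (cong length (L.filter-none P? (All.map⁺ (universal (λ _ → ¬qx ∘ P⇒Q) ys))))

_⊕_ : ∀ {m} → Vec Bool m → Vec Bool m → Vec Bool m
_⊕_ = zipWith _xor_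

length-allFlags : ∀ m → length (allFlags m) ≡ 2 ^ m
length-allFlags zero    = refl
length-allFlags (suc m) = begin
  length (map (true ∷_) (allFlags m) ++ map (false ∷_) (allFlags m))
    ≡⟨ L.length-++ (map (true ∷_) (allFlags m)) ⟩
  length (map (true ∷_) (allFlags m)) + length (map (false ∷_) (allFlags m))
    ≡⟨ cong₂ _+_ (L.length-map (true ∷_) (allFlags m)) (L.length-map (false ∷_) (allFlags m)) ⟩
  length (allFlags m) + length (allFlags m)
    ≡⟨ cong₂ _+_ (length-allFlags m) (trans (length-allFlags m) (sym (+-identityʳ (2 ^ m)))) ⟩
  2 ^ m + (2 ^ m + 0) ∎
  where open ≡-Reasoning

∈-allFlags : ∀ {m} (f : Vec Bool m) → f ∈ allFlags m
∈-allFlags []          = here refl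
∈-allFlags (true ∷ f)  = ∈-++⁺ˡ (∈-map⁺ (true ∷_) (∈-allFlags f))
∈-allFlags (false ∷ f) = ∈-++⁺ʳ (map (true ∷_) (allFlags _)) (∈-map⁺ (false ∷_) (∈-allFlags f))

module _ {p : Level} where

  length-filter-allFlags-suc : ∀ {m} {P : Pred (Vec Bool (suc m)) p} (P? : Decidable P) →
    length (filter P? (allFlags (suc m)))
      ≡ length (filter (P? ∘ (true ∷_)) (allFlags m)) + length (filter (P? ∘ (false ∷_)) (allFlags m))
  length-filter-allFlags-suc {m} P? = begin
    length (filter P? (map (true ∷_) (allFlags m) ++ map (false ∷_) (allFlags m)))
      ≡⟨ cong length (L.filter-++ P? (map (true ∷_) (allFlags m)) (map (false ∷_) (allFlags m))) ⟩
    length (filter P? (map (true ∷_) (allFlags m)) ++ filter P? (map (false ∷_) (allFlags m)))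
      ≡⟨ L.length-++ (filter P? (map (true ∷_) (allFlags m))) ⟩
    length (filter P? (map (true ∷_) (allFlags m))) + length (filter P? (map (false ∷_) (allFlags m)))
      ≡⟨ cong₂ _+_ (length-filter-map P? (true ∷_) (allFlags m)) (length-filter-map P? (false ∷_) (allFlags m)) ⟩
    length (filter (P? ∘ (true ∷_)) (allFlags m)) + length (filter (P? ∘ (false ∷_)) (allFlags m)) ∎
    where open ≡-Reasoning

  length-filter-allFlags-⊕ : ∀ {m} {P : Pred (Vec Bool m) p} (P? : Decidable P) μ →
    length (filter P? (allFlags m)) ≡ length (filter (P? ∘ (μ ⊕_)) (allFlags m))
  length-filter-allFlags-⊕ P? [] with does (P? [])
  ... | true  = refl
  ... | false = refl
  length-filter-allFlags-⊕ P? (b ∷ μ) = begin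
    length (filter P? (allFlags _))
      ≡⟨ length-filter-allFlags-suc P? ⟩
    length (filter (P? ∘ (true ∷_)) (allFlags _)) + length (filter (P? ∘ (false ∷_)) (allFlags _))
      ≡⟨ cong₂ _+_ (length-filter-allFlags-⊕ (P? ∘ (true ∷_)) μ) (length-filter-allFlags-⊕ (P? ∘ (false ∷_)) μ) ⟩
    translated true + translated false
      ≡⟨ swapHalves b ⟩
    translated (b xor true) + translated (b xor false)
      ≡⟨ length-filter-allFlags-suc (P? ∘ ((b ∷ μ) ⊕_)) ⟨
    length (filter (P? ∘ ((b ∷ μ) ⊕_)) (allFlags _)) ∎
    where
    open ≡-Reasoning
    translated : Bool → ℕ
    translated c = length (filter (λ f → P? (c ∷ (μ ⊕ f))) (allFlags _))
    swapHalves : ∀ b → translated true + translated false ≡ translated (b xor true) + translated (b xor false)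
    swapHalves false = refl
    swapHalves true  = +-comm (translated true) (translated false)

count≡multF+multF : ∀ {d m} (v : Vec (Fin d) m) (f : Vec Bool m) u →
                    count v u ≡ multF v f true u + multF v f false u
count≡multF+multF []      []       u = refl
count≡multF+multF (x ∷ v) (true ∷ f) u with does (x F.≟ u)
... | true  = cong suc (count≡multF+multF v f u)
... | false = count≡multF+multF v f u
count≡multF+multF (x ∷ v) (false ∷ f) u with does (x F.≟ u)
... | true  = trans (cong suc (count≡multF+multF v f u)) (sym (+-suc _ _))
... | false = count≡multF+multF v f u

count-++ : ∀ {d m n} (v : Vec (Fin d) m) (w : Vec (Fin d) n) u →
           count (v V.++ w) u ≡ count v u + count w u
count-++ []      w u = refl
count-++ (x ∷ v) w u = trans (cong (_+_ hit) (count-++ v w u)) (sym (+-assoc hit (count v u) (count w u)))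
  where
  hit : ℕ
  hit = ⟦ does (x F.≟ u) ⟧

length-filter-toList : ∀ {d k p} {P : Pred (Fin d) p} (P? : Decidable P) (v : Vec (Fin d) k) →
  length (filter P? (toList v)) ≡ ∑ (λ u → if does (P? u) then count v u else 0)
length-filter-toList {d} P? [] = sym (trans (∑-cong λ u → if-0-0 (does (P? u))) (∑-zero {d}))
  where
  if-0-0 : ∀ b → (if b then 0 else 0) ≡ 0
  if-0-0 true  = refl
  if-0-0 false = refl
length-filter-toList P? (x ∷ v) = begin
  length (filter P? (x ∷ toList v))
    ≡⟨ length-filter-∷ P? x (toList v) ⟩
  ind x + length (filter P? (toList v))
    ≡⟨ cong₂ _+_ (sym (∑-indicator x ind)) (length-filter-toList P? v) ⟩
  ∑ (λ u → if does (x F.≟ u) then ind u else 0) + ∑ rest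
    ≡⟨ sum-map-+ (λ u → if does (x F.≟ u) then ind u else 0) rest (allFin _) ⟨
  ∑ (λ u → (if does (x F.≟ u) then ind u else 0) + rest u)
    ≡⟨ ∑-cong (λ u → distribute (does (P? u)) (does (x F.≟ u)) (count v u)) ⟩
  ∑ (λ u → if does (P? u) then count (x ∷ v) u else 0) ∎
  where
  open ≡-Reasoning
  ind rest : Fin _ → ℕ
  ind u  = ⟦ does (P? u) ⟧
  rest u = if does (P? u) then count v u else 0
  distribute : ∀ b c n → (if c then ⟦ b ⟧ else 0) + (if b then n else 0) ≡ (if b then ⟦ c ⟧ + n else 0)
  distribute true  true  n = refl
  distribute true  false n = refl
  distribute false true  n = refl
  distribute false false n = refl

splitOverlap : ∀ {d m} → Vec (Fin d) m → Vec Bool m → ℕ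
splitOverlap Sp f = ∑ (λ u → multF Sp f true u ⊓ multF Sp f false u)

jointMult : ∀ {d m} → Vec (Fin d) m → Vec Bool m → Vec Bool m → Bool → Bool → Fin d → ℕ
jointMult []       []      []      s t u = 0
jointMult (x ∷ xs) (a ∷ μ) (b ∷ f) s t u =
  ⟦ does (x F.≟ u) ∧ does (a B.≟ s) ∧ does (b B.≟ t) ⟧ + jointMult xs μ f s t u

private
  split-second : ∀ c a b t j₁ j₂ → ⟦ c ∧ does (b B.≟ t) ⟧ + (j₁ + j₂)
    ≡ (⟦ c ∧ does (a B.≟ true) ∧ does (b B.≟ t) ⟧ + j₁) + (⟦ c ∧ does (a B.≟ false) ∧ does (b B.≟ t) ⟧ + j₂)
  split-second false _     _     _     j₁ j₂ = refl
  split-second true  true  true  true  j₁ j₂ = refl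
  split-second true  true  true  false j₁ j₂ = refl
  split-second true  true  false true  j₁ j₂ = refl
  split-second true  true  false false j₁ j₂ = refl
  split-second true  false true  true  j₁ j₂ = sym (+-suc j₁ j₂)
  split-second true  false true  false j₁ j₂ = refl
  split-second true  false false true  j₁ j₂ = refl
  split-second true  false false false j₁ j₂ = sym (+-suc j₁ j₂)

  split-first : ∀ c a b s j₁ j₂ → ⟦ c ∧ does (a B.≟ s) ⟧ + (j₁ + j₂)
    ≡ (⟦ c ∧ does (a B.≟ s) ∧ does (b B.≟ true) ⟧ + j₁) + (⟦ c ∧ does (a B.≟ s) ∧ does (b B.≟ false) ⟧ + j₂)
  split-first false _     _     _     j₁ j₂ = refl
  split-first true  true  true  true  j₁ j₂ = refl
  split-first true  true  true  false j₁ j₂ = refl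
  split-first true  true  false true  j₁ j₂ = sym (+-suc j₁ j₂)
  split-first true  true  false false j₁ j₂ = refl
  split-first true  false true  true  j₁ j₂ = refl
  split-first true  false true  false j₁ j₂ = refl
  split-first true  false false true  j₁ j₂ = refl
  split-first true  false false false j₁ j₂ = sym (+-suc j₁ j₂)

  split-xor : ∀ c a b t j₁ j₂ → ⟦ c ∧ does ((a xor b) B.≟ t) ⟧ + (j₁ + j₂)
    ≡ (⟦ c ∧ does (a B.≟ true) ∧ does (b B.≟ not t) ⟧ + j₁) + (⟦ c ∧ does (a B.≟ false) ∧ does (b B.≟ t) ⟧ + j₂)
  split-xor false _     _     _     j₁ j₂ = refl
  split-xor true  true  true  true  j₁ j₂ = refl
  split-xor true  true  true  false j₁ j₂ = refl
  split-xor true  true  false true  j₁ j₂ = refl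
  split-xor true  true  false false j₁ j₂ = refl
  split-xor true  false true  true  j₁ j₂ = sym (+-suc j₁ j₂)
  split-xor true  false true  false j₁ j₂ = refl
  split-xor true  false false true  j₁ j₂ = refl
  split-xor true  false false false j₁ j₂ = sym (+-suc j₁ j₂)

module _ {d : ℕ} where

  multF≡jointMult-second : ∀ {m} (Sp : Vec (Fin d) m) μ f t u →
    multF Sp f t u ≡ jointMult Sp μ f true t u + jointMult Sp μ f false t u
  multF≡jointMult-second []       []      []      t u = refl
  multF≡jointMult-second (x ∷ xs) (a ∷ μ) (b ∷ f) t u =
    trans (cong (_+_ ⟦ does (x F.≟ u) ∧ does (b B.≟ t) ⟧) (multF≡jointMult-second xs μ f t u))
          (split-second (does (x F.≟ u)) a b t _ _)

  multF≡jointMult-first : ∀ {m} (Sp : Vec (Fin d) m) μ f s u →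
    multF Sp μ s u ≡ jointMult Sp μ f s true u + jointMult Sp μ f s false u
  multF≡jointMult-first []       []      []      s u = refl
  multF≡jointMult-first (x ∷ xs) (a ∷ μ) (b ∷ f) s u =
    trans (cong (_+_ ⟦ does (x F.≟ u) ∧ does (a B.≟ s) ⟧) (multF≡jointMult-first xs μ f s u))
          (split-first (does (x F.≟ u)) a b s _ _)

  multF-⊕≡jointMult : ∀ {m} (Sp : Vec (Fin d) m) μ f t u →
    multF Sp (μ ⊕ f) t u ≡ jointMult Sp μ f true (not t) u + jointMult Sp μ f false t u
  multF-⊕≡jointMult []       []      []      t u = refl
  multF-⊕≡jointMult (x ∷ xs) (a ∷ μ) (b ∷ f) t u =
    trans (cong (_+_ ⟦ does (x F.≟ u) ∧ does ((a xor b) B.≟ t) ⟧) (multF-⊕≡jointMult xs μ f t u))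
          (split-xor (does (x F.≟ u)) a b t _ _)

  splitOverlap-⊕ : ∀ {m} (Sp : Vec (Fin d) m) μ f →
                   splitOverlap Sp μ ≤ splitOverlap Sp f + splitOverlap Sp (μ ⊕ f)
  splitOverlap-⊕ Sp μ f = ≤-trans (sum-map-mono-≤ at (allFin d))
                                  (≤-reflexive (sum-map-+ (overlapAt f) (overlapAt (μ ⊕ f)) (allFin d)))
    where
    overlapAt : Vec Bool _ → Fin d → ℕ
    overlapAt g u = multF Sp g true u ⊓ multF Sp g false u
    at : ∀ u → overlapAt μ u ≤ overlapAt f u + overlapAt (μ ⊕ f) u
    -- With a, b, c, d the joint counts at u for the flag pairs (μ, f) = TT, TF, FT, FF, the two
    -- counts of μ, f and μ ⊕ f are (a + b, c + d), (a + c, b + d) and (b + c, a + d).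
    at u = begin
      overlapAt μ u
        ≡⟨ cong₂ _⊓_ (multF≡jointMult-first Sp μ f true u) (multF≡jointMult-first Sp μ f false u) ⟩
      (c true true + c true false) ⊓ (c false true + c false false)
        ≤⟨ [a+b]⊓[c+d]≤[a+c]⊓[b+d]+[b+c]⊓[a+d] (c true true) (c true false) (c false true) (c false false) ⟩
      (c true true + c false true) ⊓ (c true false + c false false)
        + (c true false + c false true) ⊓ (c true true + c false false)
        ≡⟨ cong₂ _+_ (cong₂ _⊓_ (multF≡jointMult-second Sp μ f true u) (multF≡jointMult-second Sp μ f false u))
                     (cong₂ _⊓_ (multF-⊕≡jointMult Sp μ f true u) (multF-⊕≡jointMult Sp μ f false u)) ⟨
      overlapAt f u + overlapAt (μ ⊕ f) u ∎
      where
      open ≤-Reasoning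
      c : Bool → Bool → ℕ
      c s t = jointMult Sp μ f s t u

Balanced : ∀ {d m} → Vec (Fin d) m → Vec Bool m → Set
Balanced Sp μ = ∀ u → multF Sp μ true u ≤ suc (multF Sp μ false u)
                    × multF Sp μ false u ≤ suc (multF Sp μ true u)

balanced-flagging : ∀ {d m} (Sp : Vec (Fin d) m) → ∃[ μ ] Balanced Sp μ
balanced-flagging []       = [] , λ _ → z≤n , z≤n
balanced-flagging (x ∷ xs) with balanced-flagging xs
... | μ , balanced = does (t ≤? f) ∷ μ , extend (t ≤? f)
  where
  t f : ℕ
  t = multF xs μ true x
  f = multF xs μ false x
  extend : (t≤?f : Dec (t ≤ f)) → Balanced (x ∷ xs) (does t≤?f ∷ μ)
  extend _ u with x F.≟ u
  ... | no _ = balanced u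
  extend (yes t≤f) u | yes refl = s≤s t≤f , m≤n⇒m≤1+n (proj₂ (balanced x))
  extend (no t≰f)  u | yes refl = m≤n⇒m≤1+n (proj₁ (balanced x)) , m≤n⇒m≤1+n (≰⇒> t≰f)

Np≤3*splitOverlap : ∀ {d m} (Sp : Vec (Fin d) m) {μ} → Balanced Sp μ → Np Sp ≤ 3 * splitOverlap Sp μ
Np≤3*splitOverlap {d} Sp {μ} balanced = begin
  Np Sp
    ≡⟨ length-filter-toList (λ u → 2 ≤? count Sp u) Sp ⟩
  ∑ (λ u → if does (2 ≤? count Sp u) then count Sp u else 0)
    ≤⟨ sum-map-mono-≤ at (allFin d) ⟩
  ∑ (λ u → 3 * (multF Sp μ true u ⊓ multF Sp μ false u))
    ≡⟨ sum-map-* 3 (λ u → multF Sp μ true u ⊓ multF Sp μ false u) (allFin d) ⟩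
  3 * splitOverlap Sp μ ∎
  where
  open ≤-Reasoning
  at : ∀ u → (if does (2 ≤? count Sp u) then count Sp u else 0) ≤ 3 * (multF Sp μ true u ⊓ multF Sp μ false u)
  at u = subst (λ c → (if does (2 ≤? c) then c else 0) ≤ 3 * (multF Sp μ true u ⊓ multF Sp μ false u))
               (sym (count≡multF+multF Sp μ u))
               (balanced-duplicates-bound (proj₁ (balanced u)) (proj₂ (balanced u)) (2 ≤? _))

4*Np≤12*splitOverlap+12*splitOverlap : ∀ {d m} (Sp : Vec (Fin d) m) {μ} → Balanced Sp μ → ∀ f →
  4 * Np Sp ≤ 12 * splitOverlap Sp f + 12 * splitOverlap Sp (μ ⊕ f)
4*Np≤12*splitOverlap+12*splitOverlap Sp {μ} balanced f = begin
  4 * Np Sp                                             ≤⟨ *-monoʳ-≤ 4 (Np≤3*splitOverlap Sp balanced) ⟩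
  4 * (3 * splitOverlap Sp μ)                           ≡⟨ *-assoc 4 3 (splitOverlap Sp μ) ⟨
  12 * splitOverlap Sp μ                                ≤⟨ *-monoʳ-≤ 12 (splitOverlap-⊕ Sp μ f) ⟩
  12 * (splitOverlap Sp f + splitOverlap Sp (μ ⊕ f))    ≡⟨ *-distribˡ-+ 12 (splitOverlap Sp f) _ ⟩
  12 * splitOverlap Sp f + 12 * splitOverlap Sp (μ ⊕ f) ∎
  where open ≤-Reasoning

prefixFlags : ∀ {m} → ℕ → Vec Bool m → Vec Bool m
prefixFlags zero    μ       = replicate _ false
prefixFlags (suc k) []      = []
prefixFlags (suc k) (b ∷ μ) = b ∷ prefixFlags k μ

prefixFlags-all : ∀ {m} (μ : Vec Bool m) → prefixFlags m μ ≡ μ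
prefixFlags-all []      = refl
prefixFlags-all (b ∷ μ) = cong (b ∷_) (prefixFlags-all μ)

hitAt : ∀ {d m} → ℕ → Vec (Fin d) m → Fin d → ℕ
hitAt k       []       u = 0
hitAt zero    (x ∷ xs) u = ⟦ does (x F.≟ u) ⟧
hitAt (suc k) (x ∷ xs) u = hitAt k xs u

∑-hitAt≤1 : ∀ {d m} k (Sp : Vec (Fin d) m) → ∑ (hitAt k Sp) ≤ 1
∑-hitAt≤1 {d} k       []       = ≤-trans (≤-reflexive (∑-zero {d})) z≤n
∑-hitAt≤1     zero    (x ∷ xs) = ≤-reflexive (∑-indicator x (λ _ → 1))
∑-hitAt≤1     (suc k) (x ∷ xs) = ∑-hitAt≤1 k xs

multF-prefixFlags-suc : ∀ {d m} (Sp : Vec (Fin d) m) μ k t u →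
  multF Sp (prefixFlags (suc k) μ) t u ≤ multF Sp (prefixFlags k μ) t u + hitAt k Sp u
multF-prefixFlags-suc []       []      k       t u = z≤n
multF-prefixFlags-suc (x ∷ xs) (b ∷ μ) zero    t u = begin
  ⟦ c ∧ does (b B.≟ t) ⟧ + rest         ≤⟨ +-monoˡ-≤ rest (⟦∧⟧≤⟦⟧ c (does (b B.≟ t))) ⟩
  ⟦ c ⟧ + rest                          ≡⟨ +-comm ⟦ c ⟧ rest ⟩
  rest + ⟦ c ⟧                          ≤⟨ +-monoˡ-≤ ⟦ c ⟧ (m≤n+m rest _) ⟩
  ⟦ c ∧ does (false B.≟ t) ⟧ + rest + ⟦ c ⟧ ∎
  where
  open ≤-Reasoning
  c : Bool
  c = does (x F.≟ u)
  rest : ℕ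
  rest = multF xs (replicate _ false) t u
  ⟦∧⟧≤⟦⟧ : ∀ c e → ⟦ c ∧ e ⟧ ≤ ⟦ c ⟧
  ⟦∧⟧≤⟦⟧ true  true  = ≤-refl
  ⟦∧⟧≤⟦⟧ true  false = z≤n
  ⟦∧⟧≤⟦⟧ false _     = z≤n
multF-prefixFlags-suc (x ∷ xs) (b ∷ μ) (suc k) t u =
  ≤-trans (+-monoʳ-≤ h (multF-prefixFlags-suc xs μ k t u))
          (≤-reflexive (sym (+-assoc h (multF xs (prefixFlags k μ) t u) (hitAt k xs u))))
  where
  h : ℕ
  h = ⟦ does (x F.≟ u) ∧ does (b B.≟ t) ⟧

splitOverlap-prefixFlags-suc : ∀ {d m} (Sp : Vec (Fin d) m) μ k →
  splitOverlap Sp (prefixFlags (suc k) μ) ≤ splitOverlap Sp (prefixFlags k μ) + 1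
splitOverlap-prefixFlags-suc {d} Sp μ k = begin
  splitOverlap Sp (prefixFlags (suc k) μ)
    ≤⟨ sum-map-mono-≤ at (allFin d) ⟩
  ∑ (λ u → overlapAt u + hitAt k Sp u)
    ≡⟨ sum-map-+ overlapAt (hitAt k Sp) (allFin d) ⟩
  splitOverlap Sp (prefixFlags k μ) + ∑ (hitAt k Sp)
    ≤⟨ +-monoʳ-≤ (splitOverlap Sp (prefixFlags k μ)) (∑-hitAt≤1 k Sp) ⟩
  splitOverlap Sp (prefixFlags k μ) + 1 ∎
  where
  open ≤-Reasoning
  overlapAt : Fin d → ℕ
  overlapAt u = multF Sp (prefixFlags k μ) true u ⊓ multF Sp (prefixFlags k μ) false u
  at : ∀ u → multF Sp (prefixFlags (suc k) μ) true u ⊓ multF Sp (prefixFlags (suc k) μ) false u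
             ≤ overlapAt u + hitAt k Sp u
  at u = ≤-trans (⊓-mono-≤ (multF-prefixFlags-suc Sp μ k true u) (multF-prefixFlags-suc Sp μ k false u))
                 (≤-reflexive (sym (+-distribʳ-⊓ (hitAt k Sp u) _ _)))

splitOverlap-allFalse : ∀ {d m} (Sp : Vec (Fin d) m) → splitOverlap Sp (replicate m false) ≡ 0
splitOverlap-allFalse {d} Sp =
  trans (∑-cong λ u → cong (_⊓ multF Sp (replicate _ false) false u) (noneFlagged Sp u)) (∑-zero {d})
  where
  noneFlagged : ∀ {m} (Sp : Vec (Fin d) m) u → multF Sp (replicate m false) true u ≡ 0
  noneFlagged []       u = refl
  noneFlagged (x ∷ xs) u with does (x F.≟ u)
  ... | true  = noneFlagged xs u
  ... | false = noneFlagged xs u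

bounded-increments-cross : ∀ (s : ℕ → ℕ) c → (∀ k → s (suc k) ≤ c + s k) →
  ∀ {θ} m → s 0 ≤ θ → θ ≤ s m → ∃[ k ] θ ≤ s k × s k ≤ c + θ
bounded-increments-cross s c step {θ} zero    s₀≤θ θ≤s₀ = 0 , θ≤s₀ , ≤-trans s₀≤θ (m≤n+m θ c)
bounded-increments-cross s c step {θ} (suc m) s₀≤θ θ≤sₘ₊₁ with θ ≤? s m
... | yes θ≤sₘ = bounded-increments-cross s c step m s₀≤θ θ≤sₘ
... | no  θ≰sₘ = suc m , θ≤sₘ₊₁ , ≤-trans (step m) (+-monoʳ-≤ c (<⇒≤ (≰⇒> θ≰sₘ)))

near-threshold-flagging : ∀ {d m} (Sp : Vec (Fin d) m) {μ} → Balanced Sp μ →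
  ∃[ w ] Np Sp ≤ 12 * splitOverlap Sp w × 12 * splitOverlap Sp w ≤ 12 + Np Sp
near-threshold-flagging {m = m} Sp {μ} balanced =
  let k , Np≤12*overlap , 12*overlap≤12+Np = bounded-increments-cross s 12 step m s₀≤Np Np≤sₘ
  in  prefixFlags k μ , Np≤12*overlap , 12*overlap≤12+Np
  where
  s : ℕ → ℕ
  s k = 12 * splitOverlap Sp (prefixFlags k μ)
  step : ∀ k → s (suc k) ≤ 12 + s k
  step k = ≤-trans (*-monoʳ-≤ 12 (splitOverlap-prefixFlags-suc Sp μ k))
                   (≤-reflexive (trans (*-distribˡ-+ 12 (splitOverlap Sp (prefixFlags k μ)) 1) (+-comm _ 12)))
  s₀≤Np : s 0 ≤ Np Sp
  s₀≤Np = ≤-trans (≤-reflexive (cong (12 *_) (splitOverlap-allFalse Sp))) z≤n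
  Np≤sₘ : Np Sp ≤ s m
  Np≤sₘ = begin
    Np Sp                   ≤⟨ Np≤3*splitOverlap Sp balanced ⟩
    3 * splitOverlap Sp μ   ≤⟨ *-monoˡ-≤ (splitOverlap Sp μ) (m≤m+n 3 9) ⟩
    12 * splitOverlap Sp μ  ≡⟨ cong (λ f → 12 * splitOverlap Sp f) (prefixFlags-all μ) ⟨
    s m                     ∎
    where open ≤-Reasoning

SmallOverlap : ∀ {d m} → Vec (Fin d) m → Vec Bool m → Set
SmallOverlap Sp f = 12 * splitOverlap Sp f + 600 < Np Sp

SmallOverlap? : ∀ {d m} (Sp : Vec (Fin d) m) → Decidable (SmallOverlap Sp)
SmallOverlap? Sp f = 12 * splitOverlap Sp f + 600 <? Np Sp

small-overlap-pair-impossible : ∀ {N x y} → 4 * N ≤ x + y → x ≤ 12 + N → ¬ y + 600 < N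
small-overlap-pair-impossible {N} {x} {y} 4N≤x+y x≤12+N y+600<N = <-irrefl refl (begin-strict
  4 * N + 600                ≤⟨ +-monoˡ-≤ 600 4N≤x+y ⟩
  x + y + 600                ≡⟨ +-assoc x y 600 ⟩
  x + (y + 600)              <⟨ +-mono-≤-< x≤12+N y+600<N ⟩
  12 + N + N                 ≤⟨ m≤m+n (12 + N + N) (2 * N + 588) ⟩
  12 + N + N + (2 * N + 588) ≡⟨ regroup N ⟩
  4 * N + 600                ∎)
  where
  open ≤-Reasoning
  regroup : ∀ N → 12 + N + N + (2 * N + 588) ≡ 4 * N + 600
  regroup = solve-∀

module _ {d m} (Sp : Vec (Fin d) m) {μ} (balanced : Balanced Sp μ) where

  SmallOverlap⇒¬SmallOverlap-⊕ : ∀ f → SmallOverlap Sp f → ¬ SmallOverlap Sp (μ ⊕ f)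
  SmallOverlap⇒¬SmallOverlap-⊕ f small =
    small-overlap-pair-impossible (4*Np≤12*splitOverlap+12*splitOverlap Sp balanced f)
                                  (≤-trans (m≤m+n _ 600) (≤-trans (<⇒≤ small) (m≤n+m (Np Sp) 12)))

  ∃¬SmallOverlap-pair : ∃[ w ] ¬ SmallOverlap Sp w × ¬ SmallOverlap Sp (μ ⊕ w)
  ∃¬SmallOverlap-pair =
    let w , Np≤12*overlap , 12*overlap≤12+Np = near-threshold-flagging Sp balanced
    in  w , ≤⇒≯ (≤-trans Np≤12*overlap (m≤m+n _ 600))
          , small-overlap-pair-impossible (4*Np≤12*splitOverlap+12*splitOverlap Sp balanced w)
                                          12*overlap≤12+Np

sumℤ-map-difference : ∀ {a} {A : Set a} (f g : A → ℕ) xs →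
  sumℤ (map (λ x → + f x ℤ.- + g x) xs) ≡ + sum (map f xs) ℤ.- + sum (map g xs)
sumℤ-map-difference f g []       = refl
sumℤ-map-difference f g (x ∷ xs) = begin
  (+ f x ℤ.- + g x) ℤ.+ sumℤ (map (λ x → + f x ℤ.- + g x) xs)
    ≡⟨ cong (ℤ._+_ (+ f x ℤ.- + g x)) (sumℤ-map-difference f g xs) ⟩
  (+ f x ℤ.- + g x) ℤ.+ (+ sum (map f xs) ℤ.- + sum (map g xs))
    ≡⟨ regroup (+ f x) (+ g x) (+ sum (map f xs)) (+ sum (map g xs)) ⟩
  (+ f x ℤ.+ + sum (map f xs)) ℤ.- (+ g x ℤ.+ + sum (map g xs))
    ≡⟨ cong₂ ℤ._-_ (ℤ.pos-+ (f x) _) (ℤ.pos-+ (g x) _) ⟨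
  + sum (map f (x ∷ xs)) ℤ.- + sum (map g (x ∷ xs)) ∎
  where
  open ≡-Reasoning
  regroup : ∀ a b c e → (a ℤ.- b) ℤ.+ (c ℤ.- e) ≡ (a ℤ.+ c) ℤ.- (b ℤ.+ e)
  regroup = ℤ.solve-∀

+a-+b<+c-+e⇒a+e<c+b : ∀ a b c e → + a ℤ.- + b ℤ.< + c ℤ.- + e → a + e < c + b
+a-+b<+c-+e⇒a+e<c+b a b c e lt = ℤ.drop‿+<+ (begin-strict
  + (a + e)                         ≡⟨ ℤ.pos-+ a e ⟩
  + a ℤ.+ + e                       ≡⟨ cancelˡ (+ a) (+ b) (+ e) ⟨
  (+ a ℤ.- + b) ℤ.+ (+ b ℤ.+ + e)   <⟨ ℤ.+-monoˡ-< (+ b ℤ.+ + e) lt ⟩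
  (+ c ℤ.- + e) ℤ.+ (+ b ℤ.+ + e)   ≡⟨ cancelʳ (+ c) (+ e) (+ b) ⟩
  + c ℤ.+ + b                       ≡⟨ ℤ.pos-+ c b ⟨
  + (c + b)                         ∎)
  where
  open ℤ.≤-Reasoning
  cancelˡ : ∀ x y z → (x ℤ.- y) ℤ.+ (y ℤ.+ z) ≡ x ℤ.+ z
  cancelˡ = ℤ.solve-∀
  cancelʳ : ∀ x y z → (x ℤ.- y) ℤ.+ (z ℤ.+ y) ≡ x ℤ.+ z
  cancelʳ = ℤ.solve-∀

module _ {d m n} (Sp : Vec (Fin d) m) (Sq : Vec (Fin d) n) (f : Vec Bool m) (g : Vec Bool n) where

  crossDist : Fin d → ℕ
  crossDist u = ∣ multF Sp f true u - multF Sq g true u ∣ + ∣ multF Sp f false u - multF Sq g false u ∣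

  splitDist : Fin d → ℕ
  splitDist u = ∣ multF Sp f true u - multF Sp f false u ∣ + ∣ multF Sq g true u - multF Sq g false u ∣

  2*splitOverlap+∑splitDist≤∑crossDist+2*Nq :
    2 * splitOverlap Sp f + ∑ splitDist ≤ ∑ crossDist + 2 * Nq Sp Sq
  2*splitOverlap+∑splitDist≤∑crossDist+2*Nq = begin
    2 * splitOverlap Sp f + ∑ splitDist
      ≡⟨ cong (_+ ∑ splitDist) (sum-map-* 2 overlapAt (allFin d)) ⟨
    ∑ (λ u → 2 * overlapAt u) + ∑ splitDist
      ≡⟨ sum-map-+ (λ u → 2 * overlapAt u) splitDist (allFin d) ⟨
    ∑ (λ u → 2 * overlapAt u + splitDist u)
      ≤⟨ sum-map-mono-≤ at (allFin d) ⟩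
    ∑ (λ u → crossDist u + 2 * duplicatedInSq u)
      ≡⟨ sum-map-+ crossDist (λ u → 2 * duplicatedInSq u) (allFin d) ⟩
    ∑ crossDist + ∑ (λ u → 2 * duplicatedInSq u)
      ≡⟨ cong (_+_ (∑ crossDist)) (sum-map-* 2 duplicatedInSq (allFin d)) ⟩
    ∑ crossDist + 2 * ∑ duplicatedInSq
      ≡⟨ cong (λ k → ∑ crossDist + 2 * k) (length-filter-toList (λ u → 2 ≤? count (Sp V.++ Sq) u) Sq) ⟨
    ∑ crossDist + 2 * Nq Sp Sq ∎
    where
    open ≤-Reasoning
    overlapAt : Fin d → ℕ
    overlapAt u = multF Sp f true u ⊓ multF Sp f false u
    duplicatedInSq : Fin d → ℕ
    duplicatedInSq u = if does (2 ≤? count (Sp V.++ Sq) u) then count Sq u else 0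
    at : ∀ u → 2 * overlapAt u + splitDist u ≤ crossDist u + 2 * duplicatedInSq u
    at u rewrite count-++ Sp Sq u | count≡multF+multF Sp f u | count≡multF+multF Sq g u =
      Z-summand-bound (multF Sp f true u) (multF Sp f false u) (multF Sq g true u) (multF Sq g false u)

  bad⇒SmallOverlap : (+ 6) ℤ.* Z Sp Sq f g ℤ.< + Np Sp ℤ.- + (12 * Nq Sp Sq) ℤ.- + 600 →
                     SmallOverlap Sp f
  bad⇒SmallOverlap bad = +-cancelʳ-< (6 * ∑ splitDist) _ _ (begin-strict
    12 * splitOverlap Sp f + 600 + 6 * ∑ splitDist
      ≡⟨ regroupˡ (splitOverlap Sp f) (∑ splitDist) ⟩
    6 * (2 * splitOverlap Sp f + ∑ splitDist) + 600
      ≤⟨ +-monoˡ-≤ 600 (*-monoʳ-≤ 6 2*splitOverlap+∑splitDist≤∑crossDist+2*Nq) ⟩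
    6 * (∑ crossDist + 2 * Nq Sp Sq) + 600
      ≡⟨ regroupʳ (∑ crossDist) (Nq Sp Sq) ⟩
    6 * ∑ crossDist + (12 * Nq Sp Sq + 600)
      <⟨ +a-+b<+c-+e⇒a+e<c+b (6 * ∑ crossDist) (6 * ∑ splitDist) (Np Sp) (12 * Nq Sp Sq + 600)
                             (subst₂ ℤ._<_ scaled-Z shifted-bound bad) ⟩
    Np Sp + 6 * ∑ splitDist ∎)
    where
    open ≤-Reasoning
    regroupˡ : ∀ r s → 12 * r + 600 + 6 * s ≡ 6 * (2 * r + s) + 600
    regroupˡ = solve-∀
    regroupʳ : ∀ c q → 6 * (c + 2 * q) + 600 ≡ 6 * c + (12 * q + 600)
    regroupʳ = solve-∀
    scaled-Z : (+ 6) ℤ.* Z Sp Sq f g ≡ + (6 * ∑ crossDist) ℤ.- + (6 * ∑ splitDist)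
    scaled-Z = trans (cong (ℤ._*_ (+ 6)) (sumℤ-map-difference crossDist splitDist (allFin d)))
              (trans (distrib (+ 6) (+ ∑ crossDist) (+ ∑ splitDist))
                     (sym (cong₂ ℤ._-_ (ℤ.pos-* 6 (∑ crossDist)) (ℤ.pos-* 6 (∑ splitDist)))))
      where
      distrib : ∀ k x y → k ℤ.* (x ℤ.- y) ≡ k ℤ.* x ℤ.- k ℤ.* y
      distrib = ℤ.solve-∀
    shifted-bound : + Np Sp ℤ.- + (12 * Nq Sp Sq) ℤ.- + 600 ≡ + Np Sp ℤ.- + (12 * Nq Sp Sq + 600)
    shifted-bound = trans (assoc (+ Np Sp) (+ (12 * Nq Sp Sq)) (+ 600))
                          (cong (ℤ._-_ (+ Np Sp)) (sym (ℤ.pos-+ (12 * Nq Sp Sq) 600)))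
      where
      assoc : ∀ x y z → x ℤ.- y ℤ.- z ≡ x ℤ.- (y ℤ.+ z)
      assoc = ℤ.solve-∀

#SmallOverlap : ∀ {d m} → Vec (Fin d) m → ℕ
#SmallOverlap {m = m} Sp = length (filter (SmallOverlap? Sp) (allFlags m))

badCount≤#SmallOverlap*2^n : ∀ {d m n} (Sp : Vec (Fin d) m) (Sq : Vec (Fin d) n) →
                             badCount Sp Sq ≤ #SmallOverlap Sp * 2 ^ n
badCount≤#SmallOverlap*2^n {m = m} {n} Sp Sq = begin
  badCount Sp Sq
    ≤⟨ length-filter-cartesianProduct _ (SmallOverlap? Sp) (λ {f} {g} → bad⇒SmallOverlap Sp Sq f g)
                                      (allFlags m) (allFlags n) ⟩
  #SmallOverlap Sp * length (allFlags n)
    ≡⟨ cong (_*_ (#SmallOverlap Sp)) (length-allFlags n) ⟩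
  #SmallOverlap Sp * 2 ^ n ∎
  where open ≤-Reasoning

#SmallOverlap*2<2^m : ∀ {d m} (Sp : Vec (Fin d) m) → #SmallOverlap Sp * 2 < 2 ^ m
#SmallOverlap*2<2^m {m = m} Sp =
  let μ , balanced = balanced-flagging Sp
      w , ¬small-w , ¬small-μ⊕w = ∃¬SmallOverlap-pair Sp balanced
  in begin-strict
  #SmallOverlap Sp * 2
    ≡⟨ *-comm (#SmallOverlap Sp) 2 ⟩
  #SmallOverlap Sp + (#SmallOverlap Sp + 0)
    ≡⟨ cong (_+_ (#SmallOverlap Sp)) (+-identityʳ (#SmallOverlap Sp)) ⟩
  #SmallOverlap Sp + #SmallOverlap Sp
    ≡⟨ cong (_+_ (#SmallOverlap Sp)) (length-filter-allFlags-⊕ (SmallOverlap? Sp) μ) ⟩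
  #SmallOverlap Sp + length (filter (SmallOverlap? Sp ∘ (μ ⊕_)) (allFlags m))
    <⟨ length-filter-disjoint-< (SmallOverlap? Sp) (SmallOverlap? Sp ∘ (μ ⊕_))
                                (SmallOverlap⇒¬SmallOverlap-⊕ Sp balanced _)
                                (∈-allFlags w) ¬small-w ¬small-μ⊕w ⟩
  length (allFlags m)
    ≡⟨ length-allFlags m ⟩
  2 ^ m ∎
  where open ≤-Reasoning

lemma4p11 : (d m n : ℕ) (Sp : Vec (Fin d) m) (Sq : Vec (Fin d) n) →
    badCount Sp Sq * 2 < 2 ^ (m + n)
lemma4p11 d m n Sp Sq = begin-strict
  badCount Sp Sq * 2            ≤⟨ *-monoˡ-≤ 2 (badCount≤#SmallOverlap*2^n Sp Sq) ⟩
  #SmallOverlap Sp * 2 ^ n * 2  ≡⟨ xy∙z≈xz∙y (#SmallOverlap Sp) (2 ^ n) 2 ⟩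
  #SmallOverlap Sp * 2 * 2 ^ n  <⟨ *-monoˡ-< (2 ^ n) {{m^n≢0 2 n}} (#SmallOverlap*2<2^m Sp) ⟩
  2 ^ m * 2 ^ n                 ≡⟨ ^-distribˡ-+-* 2 m n ⟨
  2 ^ (m + n)                   ∎
  where open ≤-Reasoning
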